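{- Let $p>3$ be a prime. Then $$\sum_{k=1}^{[p/3]}\frac{(-8)^k}{k}\equiv-3q_p(3)\pmod p.$$
   Context: $[x]$ denotes the integer part of $x$; $q_p(3)=\frac{3^{p-1}-1}{p}$. Congruences between rationals with denominators prime to $p$ are understood in the ring of $p$-integral rationals. -}

module Defs where

open import Data.Nat as ℕ using (ℕ; zero; suc)
open import Data.Nat.Divisibility using (_∣_)
open import Data.Nat.DivMod using (_/_)
open import Data.Integer as ℤ using (ℤ; +_; -[1+_])
open import Data.Rational as ℚ using (ℚ)
open import Data.Product using (∃₂; _×_)
open import Relation.Nullary using (¬_)
open import Relation.Binary.PropositionalEquality using (_≡_)

sumNeg8 : ℕ → ℚ
sumNeg8 zero    = ℚ.0ℚ
sumNeg8 (suc n) = sumNeg8 n ℚ.+ ((-[1+ 7 ] ℤ.^ suc n) ℚ./ suc n)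

fermatQuotient3 : (p : ℕ) → .{{ℕ.NonZero p}} → ℚ
fermatQuotient3 p = ((+ (3 ℕ.^ (p ℕ.∸ 1))) ℤ.- ℤ.1ℤ) ℚ./ p

-- Congruence modulo p in the ring of p-integral rationals:
-- x ≡ y (mod p) iff x - y = p·a/b with a ∈ ℤ, b a positive integer, p ∤ b.
-- (b is written as suc c to guarantee b ≠ 0.)
_≡_[modℚ_] : ℚ → ℚ → ℕ → Set
x ≡ y [modℚ p ] =
  ∃₂ λ (a : ℤ) (c : ℕ) → ¬ (p ∣ suc c) × (x ℚ.- y ≡ (+ p ℤ.* a) ℚ./ suc c)

module Submission where

-- Split (1 + 2)^m = Σ_j 2^j C(m,j) according to j mod 3 into a_m + b_m + c_m = 3^m.  Pascal's rule
-- gives a_{m+1} = a_m + 2c_m, b_{m+1} = b_m + 2a_m, c_{m+1} = c_m + 2b_m, hence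
-- a_{m+2} + 3a_m = 4·3^m, and so a_p = Σ_k 8^k C(p,3k) = 3^{p-1} for odd p.  On the other hand
-- 3k·C(p,3k) = p·C(p-1,3k-1) ≡ -p(-1)^k (mod p²), so dividing 3(a_p - 1) = 3Σ_{k≥1} 8^k C(p,3k)
-- by p yields -Σ_{k=1}^{[p/3]} (-8)^k/k modulo p.  The rational congruence is reached by clearing
-- the denominator [p/3]!, which is prime to p.

open import Defs

module Binomial where
  open import Data.Nat.Base
  open import Data.Nat.Properties
  open import Data.Nat.Combinatorics using (_C_; nCk+nC[k+1]≡[n+1]C[k+1]; nC1≡n)
  open import Data.Nat.Divisibility using (_∣_; divides; ∣⇒≤)
  open import Data.Nat.Primality using (Prime; euclidsLemma)
  open import Data.Nat.Tactic.RingSolver using (solve-∀)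
  open import Data.Sum.Base using (inj₁; inj₂)
  open import Relation.Nullary.Negation using (contradiction)
  open import Relation.Binary.PropositionalEquality
  open ≡-Reasoning

  [k+1]*[n+1]C[k+1]≡[n+1]*nCk : ∀ n k → suc k * (suc n C suc k) ≡ suc n * (n C k)
  [k+1]*[n+1]C[k+1]≡[n+1]*nCk zero    zero    = refl
  [k+1]*[n+1]C[k+1]≡[n+1]*nCk zero    (suc k) = *-zeroʳ (2 + k)
  [k+1]*[n+1]C[k+1]≡[n+1]*nCk (suc n) zero    =
    trans (*-identityˡ ((2 + n) C 1)) (trans (nC1≡n (2 + n)) (sym (*-identityʳ (2 + n))))
  [k+1]*[n+1]C[k+1]≡[n+1]*nCk (suc n) (suc k) = begin
    (2 + k) * ((2 + n) C (2 + k))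
      ≡⟨ cong ((2 + k) *_) (sym (nCk+nC[k+1]≡[n+1]C[k+1] (suc n) (suc k))) ⟩
    (2 + k) * (u + v)
      ≡⟨ split k u v ⟩
    (1 + k) * u + (2 + k) * v + u
      ≡⟨ cong₂ (λ x y → x + y + u) ([k+1]*[n+1]C[k+1]≡[n+1]*nCk n k) ([k+1]*[n+1]C[k+1]≡[n+1]*nCk n (suc k)) ⟩
    (1 + n) * (n C k) + (1 + n) * (n C suc k) + u
      ≡⟨ cong (_+ u) (sym (*-distribˡ-+ (1 + n) (n C k) (n C suc k))) ⟩
    (1 + n) * (n C k + n C suc k) + u
      ≡⟨ cong (λ x → (1 + n) * x + u) (nCk+nC[k+1]≡[n+1]C[k+1] n k) ⟩
    (1 + n) * u + u
      ≡⟨ +-comm ((1 + n) * u) u ⟩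
    (2 + n) * u
      ∎
    where
    u = (1 + n) C (1 + k)
    v = (1 + n) C (2 + k)
    split : ∀ k u v → (2 + k) * (u + v) ≡ (1 + k) * u + (2 + k) * v + u
    split = solve-∀

  prime∣pC[1+k] : ∀ {p k} → Prime p → suc k < p → p ∣ p C suc k
  prime∣pC[1+k] {suc q} {k} pr k<p
    with euclidsLemma (suc k) (suc q C suc k) pr
           (divides (q C k) (trans ([k+1]*[n+1]C[k+1]≡[n+1]*nCk q k) (*-comm (suc q) (q C k))))
  ... | inj₁ p∣k = contradiction (∣⇒≤ p∣k) (<⇒≱ k<p)
  ... | inj₂ p∣C = p∣C

module Primes where
  open import Data.Nat.Base
  open import Data.Nat.Properties
  open import Data.Nat.DivMod using (_/_; _%_; m≡m%n+[m/n]*n; m%n<n)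
  open import Data.Nat.Divisibility using (_∣_; divides; ∣⇒≤; ∣1⇒≡1; hasNonTrivialDivisor)
  open import Data.Nat.Primality using (Prime; euclidsLemma; prime⇒¬composite)
  open import Data.Product.Base using (_×_; _,_)
  open import Data.Sum.Base using (inj₁; inj₂)
  open import Relation.Nullary.Negation using (¬_; contradiction)
  open import Relation.Binary.PropositionalEquality

  prime∤m! : ∀ {p} → Prime p → ∀ m → m < p → ¬ p ∣ m !
  prime∤m! {suc (suc _)} pr zero    _   p∣1 = contradiction (∣1⇒≡1 p∣1) λ ()
  prime∤m! pr              (suc m) m<p p∣m! with euclidsLemma (suc m) (m !) pr p∣m!
  ... | inj₁ p∣m = contradiction (∣⇒≤ p∣m) (<⇒≱ m<p)
  ... | inj₂ p∣m! = prime∤m! pr m (<-trans (n<1+n m) m<p) p∣m!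

  small∤prime : ∀ {p d} → Prime p → 1 < d → d < p → ¬ d ∣ p
  small∤prime pr 1<d d<p d∣p = prime⇒¬composite pr (hasNonTrivialDivisor {{n>1⇒nonTrivial 1<d}} d<p d∣p)

  ¬3∣⇒m/3-bounds : ∀ m → ¬ 3 ∣ m → 3 * (m / 3) < m × m ≤ 2 + 3 * (m / 3)
  ¬3∣⇒m/3-bounds m 3∤m with m % 3 | m≡m%n+[m/n]*n m 3 | m%n<n m 3
  ... | 0 | m≡q*3 | _ = contradiction (divides (m / 3) m≡q*3) 3∤m
  ... | 1 | m≡1+q*3 | _ = subst (3 * q <_) (sym m≡1+3q) ≤-refl , subst (_≤ 2 + 3 * q) (sym m≡1+3q) (n≤1+n _)
    where
    q = m / 3
    m≡1+3q = trans m≡1+q*3 (cong suc (*-comm q 3))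
  ... | 2 | m≡2+q*3 | _ = subst (3 * q <_) (sym m≡2+3q) (n≤1+n _) , subst (_≤ 2 + 3 * q) (sym m≡2+3q) ≤-refl
    where
    q = m / 3
    m≡2+3q = trans m≡2+q*3 (cong (2 +_) (*-comm q 3))
  ... | suc (suc (suc _)) | _ | s<s (s<s (s<s ()))

  ¬2∣⇒odd : ∀ m → ¬ 2 ∣ m → m ≡ 1 + 2 * (m / 2)
  ¬2∣⇒odd m 2∤m with m % 2 | m≡m%n+[m/n]*n m 2 | m%n<n m 2
  ... | 0 | m≡q*2 | _ = contradiction (divides (m / 2) m≡q*2) 2∤m
  ... | 1 | m≡1+q*2 | _ = trans m≡1+q*2 (cong suc (*-comm (m / 2) 2))
  ... | suc (suc _) | _ | s<s (s<s ())

module Trisection where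
  open import Data.Nat.Base
  open import Data.Nat.Properties
  open import Data.Nat.Combinatorics using (_C_; nCk+nC[k+1]≡[n+1]C[k+1]; k>n⇒nCk≡0)
  open import Data.Nat.DivMod using (_/_)
  open import Data.Nat.Primality using (Prime)
  open import Data.Nat.Tactic.RingSolver using (solve-∀)
  open import Data.Product.Base using (proj₂)
  open import Relation.Binary.PropositionalEquality
  open ≡-Reasoning
  open Primes using (small∤prime; ¬3∣⇒m/3-bounds; ¬2∣⇒odd)

  ∑≤ : ℕ → (ℕ → ℕ) → ℕ
  ∑≤ zero    f = f 0
  ∑≤ (suc n) f = ∑≤ n f + f (suc n)

  syntax ∑≤ n (λ k → e) = ∑[ k ≤ n ] e

  ∑-cong : ∀ n {f g} → (∀ k → f k ≡ g k) → ∑≤ n f ≡ ∑≤ n g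
  ∑-cong zero    f≡g = f≡g 0
  ∑-cong (suc n) f≡g = cong₂ _+_ (∑-cong n f≡g) (f≡g (suc n))

  ∑-distrib-+ : ∀ n f g → ∑[ k ≤ n ] (f k + g k) ≡ ∑≤ n f + ∑≤ n g
  ∑-distrib-+ zero    f g = refl
  ∑-distrib-+ (suc n) f g = begin
    ∑[ k ≤ n ] (f k + g k) + (f (suc n) + g (suc n)) ≡⟨ cong (_+ (f (suc n) + g (suc n))) (∑-distrib-+ n f g) ⟩
    ∑≤ n f + ∑≤ n g + (f (suc n) + g (suc n))         ≡⟨ interchange (∑≤ n f) (∑≤ n g) (f (suc n)) (g (suc n)) ⟩
    ∑≤ n f + f (suc n) + (∑≤ n g + g (suc n))         ∎
    where
    interchange : ∀ a b c d → a + b + (c + d) ≡ a + c + (b + d)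
    interchange = solve-∀

  *-distribˡ-∑ : ∀ c n f → c * ∑≤ n f ≡ ∑[ k ≤ n ] (c * f k)
  *-distribˡ-∑ c zero    f = refl
  *-distribˡ-∑ c (suc n) f =
    trans (*-distribˡ-+ c (∑≤ n f) (f (suc n))) (cong (_+ c * f (suc n)) (*-distribˡ-∑ c n f))

  trisection : ℕ → ℕ → ℕ → ℕ
  trisection r N m = ∑[ k ≤ N ] (2 ^ (r + 3 * k) * (m C (r + 3 * k)))

  trisection-suc-suc : ∀ r N m → trisection (suc r) N (suc m) ≡ trisection (suc r) N m + 2 * trisection r N m
  trisection-suc-suc r N m = begin
    trisection (suc r) N (suc m)
      ≡⟨ ∑-cong N pascal ⟩
    ∑[ k ≤ N ] (2 ^ (suc r + 3 * k) * (m C (suc r + 3 * k)) + 2 * (2 ^ (r + 3 * k) * (m C (r + 3 * k))))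
      ≡⟨ ∑-distrib-+ N _ _ ⟩
    trisection (suc r) N m + ∑[ k ≤ N ] (2 * (2 ^ (r + 3 * k) * (m C (r + 3 * k))))
      ≡⟨ cong (trisection (suc r) N m +_) (sym (*-distribˡ-∑ 2 N _)) ⟩
    trisection (suc r) N m + 2 * trisection r N m
      ∎
    where
    weigh : ∀ w a b → 2 * w * (a + b) ≡ 2 * w * b + 2 * (w * a)
    weigh = solve-∀
    pascal : ∀ k → 2 ^ (suc r + 3 * k) * (suc m C (suc r + 3 * k))
                 ≡ 2 ^ (suc r + 3 * k) * (m C (suc r + 3 * k)) + 2 * (2 ^ (r + 3 * k) * (m C (r + 3 * k)))
    pascal k = trans (cong (2 ^ (suc r + 3 * k) *_) (sym (nCk+nC[k+1]≡[n+1]C[k+1] m (r + 3 * k))))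
                     (weigh (2 ^ (r + 3 * k)) (m C (r + 3 * k)) (m C suc (r + 3 * k)))

  -- Pascal's rule moves the class j ≡ 2 into the class j ≡ 0; the one term with k = N + 1 falls
  -- outside the truncation and is kept on the left.
  trisection-zero-suc-boundary : ∀ N m → trisection 0 N (suc m) + 2 ^ (3 + 3 * N) * (m C (2 + 3 * N))
                                         ≡ trisection 0 N m + 2 * trisection 2 N m
  trisection-zero-suc-boundary zero m = base (m C 2)
    where
    base : ∀ x → 1 + 8 * x ≡ 1 + 2 * (4 * x)
    base = solve-∀
  trisection-zero-suc-boundary (suc N) m = begin
    X + 2 ^ (3 * suc N) * (suc m C (3 * suc N)) + 2 ^ (3 + 3 * suc N) * (m C (2 + 3 * suc N))
      ≡⟨ cong (λ i → X + 2 ^ i * (suc m C i) + 2 ^ (3 + i) * (m C (2 + i))) (*-suc 3 N) ⟩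
    X + u * (suc m C (3 + j)) + 8u * c        ≡⟨ cong (λ x → X + u * x + 8u * c) (sym (nCk+nC[k+1]≡[n+1]C[k+1] m (2 + j))) ⟩
    X + u * (a + b) + 8u * c                  ≡⟨ regroup X u a b c ⟩
    (X + u * a) + (u * b + 8u * c)            ≡⟨ cong (_+ (u * b + 8u * c)) (trisection-zero-suc-boundary N m) ⟩
    (Y + 2 * Z) + (u * b + 8u * c)            ≡⟨ regroup′ Y Z u b c ⟩
    Y + u * b + 2 * (Z + 4u * c)
      ≡⟨ cong (λ i → Y + 2 ^ i * (m C i) + 2 * (Z + 2 ^ (2 + i) * (m C (2 + i)))) (sym (*-suc 3 N)) ⟩
    trisection 0 (suc N) m + 2 * trisection 2 (suc N) m ∎
    where
    j = 3 * N
    X = trisection 0 N (suc m)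
    Y = trisection 0 N m
    Z = trisection 2 N m
    u = 2 ^ (3 + j)
    4u = 2 * (2 * u)
    8u = 2 * 4u
    a = m C (2 + j)
    b = m C (3 + j)
    c = m C (5 + j)
    regroup : ∀ X u a b c → X + u * (a + b) + 2 * (2 * (2 * u)) * c ≡ (X + u * a) + (u * b + 2 * (2 * (2 * u)) * c)
    regroup = solve-∀
    regroup′ : ∀ Y Z u b c → (Y + 2 * Z) + (u * b + 2 * (2 * (2 * u)) * c) ≡ Y + u * b + 2 * (Z + 2 * (2 * u) * c)
    regroup′ = solve-∀

  trisection-zero-suc : ∀ N m → m < 2 + 3 * N → trisection 0 N (suc m) ≡ trisection 0 N m + 2 * trisection 2 N m
  trisection-zero-suc N m m<2+3N = begin
    trisection 0 N (suc m)                                               ≡⟨ sym (+-identityʳ _) ⟩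
    trisection 0 N (suc m) + 0                                           ≡⟨ cong (trisection 0 N (suc m) +_) (sym boundary) ⟩
    trisection 0 N (suc m) + 2 ^ (3 + 3 * N) * (m C (2 + 3 * N))         ≡⟨ trisection-zero-suc-boundary N m ⟩
    trisection 0 N m + 2 * trisection 2 N m                              ∎
    where
    boundary : 2 ^ (3 + 3 * N) * (m C (2 + 3 * N)) ≡ 0
    boundary = trans (cong (2 ^ (3 + 3 * N) *_) (k>n⇒nCk≡0 m<2+3N)) (*-zeroʳ (2 ^ (3 + 3 * N)))

  trisection-at-zero : ∀ r N → trisection r N 0 ≡ 2 ^ r * (0 C r)
  trisection-at-zero r zero    = cong (λ i → 2 ^ i * (0 C i)) (+-identityʳ r)
  trisection-at-zero r (suc N) = begin
    trisection r N 0 + 2 ^ (r + 3 * suc N) * (0 C (r + 3 * suc N))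
      ≡⟨ cong₂ _+_ (trisection-at-zero r N) (cong (2 ^ (r + 3 * suc N) *_) (k>n⇒nCk≡0 0<r+3[N+1])) ⟩
    2 ^ r * (0 C r) + 2 ^ (r + 3 * suc N) * 0                     ≡⟨ cong (2 ^ r * (0 C r) +_) (*-zeroʳ (2 ^ (r + 3 * suc N))) ⟩
    2 ^ r * (0 C r) + 0                                           ≡⟨ +-identityʳ _ ⟩
    2 ^ r * (0 C r)                                               ∎
    where
    0<r+3[N+1] : 0 < r + 3 * suc N
    0<r+3[N+1] = <-≤-trans z<s (m≤n+m (3 * suc N) r)

  trisection-total : ∀ N m → m ≤ 2 + 3 * N → trisection 0 N m + trisection 1 N m + trisection 2 N m ≡ 3 ^ m
  trisection-total N zero    _       rewrite trisection-at-zero 0 N | trisection-at-zero 1 N | trisection-at-zero 2 N = refl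
  trisection-total N (suc m) m<2+3N = begin
    trisection 0 N (suc m) + trisection 1 N (suc m) + trisection 2 N (suc m)
      ≡⟨ cong₂ (λ x y → x + y + trisection 2 N (suc m)) (trisection-zero-suc N m m<2+3N) (trisection-suc-suc 0 N m) ⟩
    (a + 2 * c) + (b + 2 * a) + trisection 2 N (suc m)
      ≡⟨ cong ((a + 2 * c) + (b + 2 * a) +_) (trisection-suc-suc 1 N m) ⟩
    (a + 2 * c) + (b + 2 * a) + (c + 2 * b)            ≡⟨ triple a b c ⟩
    3 * (a + b + c)                                    ≡⟨ cong (3 *_) (trisection-total N m (<⇒≤ m<2+3N)) ⟩
    3 ^ suc m                                          ∎
    where
    a = trisection 0 N m
    b = trisection 1 N m
    c = trisection 2 N m
    triple : ∀ a b c → (a + 2 * c) + (b + 2 * a) + (c + 2 * b) ≡ 3 * (a + b + c)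
    triple = solve-∀

  trisection-two-steps : ∀ N m → 2 + m ≤ 2 + 3 * N → trisection 0 N (2 + m) + 3 * trisection 0 N m ≡ 4 * 3 ^ m
  trisection-two-steps N m 2+m≤2+3N = begin
    trisection 0 N (2 + m) + 3 * a
      ≡⟨ cong (_+ 3 * a) (trisection-zero-suc N (suc m) 2+m≤2+3N) ⟩
    trisection 0 N (suc m) + 2 * trisection 2 N (suc m) + 3 * a
      ≡⟨ cong₂ (λ x y → x + 2 * y + 3 * a) (trisection-zero-suc N m m<2+3N) (trisection-suc-suc 1 N m) ⟩
    (a + 2 * c) + 2 * (c + 2 * b) + 3 * a              ≡⟨ quadruple a b c ⟩
    4 * (a + b + c)                                    ≡⟨ cong (4 *_) (trisection-total N m (<⇒≤ m<2+3N)) ⟩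
    4 * 3 ^ m                                          ∎
    where
    a = trisection 0 N m
    b = trisection 1 N m
    c = trisection 2 N m
    m<2+3N : m < 2 + 3 * N
    m<2+3N = <-trans (n<1+n m) 2+m≤2+3N
    quadruple : ∀ a b c → (a + 2 * c) + 2 * (c + 2 * b) + 3 * a ≡ 4 * (a + b + c)
    quadruple = solve-∀

  trisection-odd : ∀ N t → 1 + 2 * t ≤ 2 + 3 * N → trisection 0 N (1 + 2 * t) ≡ 3 ^ (2 * t)
  trisection-odd N zero    _ =
    trans (trisection-zero-suc N 0 z<s) (cong₂ (λ a c → a + 2 * c) (trisection-at-zero 0 N) (trisection-at-zero 2 N))
  trisection-odd N (suc t) 3+2t≤2+3N = +-cancelʳ-≡ (3 * 9^t) (trisection 0 N (1 + 2 * suc t)) (3 ^ (2 * suc t)) (begin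
    trisection 0 N (1 + 2 * suc t) + 3 * 9^t
      ≡⟨ cong (λ i → trisection 0 N (suc i) + 3 * 9^t) (*-suc 2 t) ⟩
    trisection 0 N (2 + m) + 3 * 9^t                   ≡⟨ cong (λ x → trisection 0 N (2 + m) + 3 * x) (sym (trisection-odd N t m≤2+3N)) ⟩
    trisection 0 N (2 + m) + 3 * trisection 0 N m      ≡⟨ trisection-two-steps N m 2+m≤2+3N ⟩
    4 * 3 ^ m                                          ≡⟨ nine 9^t ⟩
    3 ^ (2 + 2 * t) + 3 * 9^t                          ≡⟨ cong (λ i → 3 ^ i + 3 * 9^t) (sym (*-suc 2 t)) ⟩
    3 ^ (2 * suc t) + 3 * 9^t                          ∎)
    where
    m = 1 + 2 * t
    9^t = 3 ^ (2 * t)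
    2+m≤2+3N : 2 + m ≤ 2 + 3 * N
    2+m≤2+3N = subst (_≤ 2 + 3 * N) (cong suc (*-suc 2 t)) 3+2t≤2+3N
    m≤2+3N : m ≤ 2 + 3 * N
    m≤2+3N = ≤-trans (m≤n+m m 2) 2+m≤2+3N
    nine : ∀ x → 4 * (3 * x) ≡ 3 * (3 * x) + 3 * x
    nine = solve-∀

  trisection-prime : ∀ {p} → Prime p → 3 < p → trisection 0 (p / 3) p ≡ 3 ^ (p ∸ 1)
  trisection-prime {p} pr 3<p = begin
    trisection 0 (p / 3) p               ≡⟨ cong (trisection 0 (p / 3)) p≡1+2t ⟩
    trisection 0 (p / 3) (1 + 2 * t)     ≡⟨ trisection-odd (p / 3) t (subst (_≤ 2 + 3 * (p / 3)) p≡1+2t p≤2+3n) ⟩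
    3 ^ (2 * t)                          ≡⟨ cong (λ i → 3 ^ (i ∸ 1)) (sym p≡1+2t) ⟩
    3 ^ (p ∸ 1)                          ∎
    where
    t = p / 2
    p≡1+2t = ¬2∣⇒odd p (small∤prime pr (s<s z<s) (<-trans (n<1+n 2) 3<p))
    p≤2+3n = proj₂ (¬3∣⇒m/3-bounds p (small∤prime pr (s<s z<s) 3<p))

module BinomialCongruences where
  open import Data.Nat.Base as ℕ using (ℕ; zero; suc; _!; z<s)
  import Data.Nat.Properties as ℕ
  open import Data.Nat.Combinatorics using (_C_; nCk+nC[k+1]≡[n+1]C[k+1])
  open import Data.Nat.Primality using (Prime)
  open import Data.Integer.Base hiding (suc; pred)
  open import Data.Integer.Properties using (pos-+; pos-*; *-zeroˡ; ^-*-assoc)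
  open import Data.Integer.Divisibility.Signed
    using (_∣_; divides; ∣ᵤ⇒∣; ∣m∣n⇒∣m+n; ∣m∣n⇒∣m-n; ∣n⇒∣m*n; *-monoʳ-∣)
  open import Data.Integer.Tactic.RingSolver using (solve-∀)
  open import Relation.Binary.PropositionalEquality
  open ≡-Reasoning
  open Binomial using ([k+1]*[n+1]C[k+1]≡[n+1]*nCk; prime∣pC[1+k])
  open Trisection using (trisection)

  pos-^ : ∀ m n → + (m ℕ.^ n) ≡ (+ m) ^ n
  pos-^ m zero    = refl
  pos-^ m (suc n) = trans (pos-* m (m ℕ.^ n)) (cong (+ m *_) (pos-^ m n))

  ^-distrib-* : ∀ i j n → (i * j) ^ n ≡ i ^ n * j ^ n
  ^-distrib-* i j zero    = refl
  ^-distrib-* i j (suc n) = trans (cong (i * j *_) (^-distrib-* i j n)) (interchange i j (i ^ n) (j ^ n))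
    where
    interchange : ∀ a b c d → a * b * (c * d) ≡ a * c * (b * d)
    interchange = solve-∀

  [p-1]Ck≡[-1]^k : ∀ {p k} → Prime p → k ℕ.< p → + p ∣ + (ℕ.pred p C k) - -1ℤ ^ k
  [p-1]Ck≡[-1]^k {suc q} {zero}  _  _   = divides 0ℤ (sym (*-zeroˡ (+ suc q)))
  [p-1]Ck≡[-1]^k {suc q} {suc k} pr k<p = subst (+ suc q ∣_) alternate
    (∣m∣n⇒∣m-n (∣ᵤ⇒∣ {i = + (suc q C suc k)} (prime∣pC[1+k] pr k<p)) ([p-1]Ck≡[-1]^k pr (ℕ.<-trans (ℕ.n<1+n k) k<p)))
    where
    pascal : + (suc q C suc k) ≡ + (q C k) + + (q C suc k)
    pascal = trans (cong +_ (sym (nCk+nC[k+1]≡[n+1]C[k+1] q k))) (pos-+ (q C k) (q C suc k))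
    cancel : ∀ a b s → (a + b) - (a - s) ≡ b - -1ℤ * s
    cancel = solve-∀
    alternate : + (suc q C suc k) - (+ (q C k) - -1ℤ ^ k) ≡ + (q C suc k) - -1ℤ ^ suc k
    alternate = trans (cong (_- (+ (q C k) - -1ℤ ^ k)) pascal) (cancel (+ (q C k)) (+ (q C suc k)) (-1ℤ ^ k))

  p²∣j*pCj+p*[-1]^j : ∀ {p j} → Prime p → 0 ℕ.< j → j ℕ.< p → + p * + p ∣ + j * + (p C j) + + p * -1ℤ ^ j
  p²∣j*pCj+p*[-1]^j {suc q} {suc i} pr _ j<p =
    subst (+ suc q * + suc q ∣_) (sym factor) (*-monoʳ-∣ (+ suc q) ([p-1]Ck≡[-1]^k pr (ℕ.<-trans (ℕ.n<1+n i) j<p)))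
    where
    absorption : + suc i * + (suc q C suc i) ≡ + suc q * + (q C i)
    absorption = trans (sym (pos-* (suc i) _)) (trans (cong +_ ([k+1]*[n+1]C[k+1]≡[n+1]*nCk q i)) (pos-* (suc q) (q C i)))
    collect : ∀ P c s → P * c + P * (-1ℤ * s) ≡ P * (c - s)
    collect = solve-∀
    factor : + suc i * + (suc q C suc i) + + suc q * -1ℤ ^ suc i ≡ + suc q * (+ (q C i) - -1ℤ ^ i)
    factor = trans (cong (_+ + suc q * -1ℤ ^ suc i) absorption) (collect (+ suc q) (+ (q C i)) (-1ℤ ^ i))

  [-8]^k≡[-1]^3k*2^3k : ∀ k → -[1+ 7 ] ^ k ≡ -1ℤ ^ (3 ℕ.* k) * + (2 ℕ.^ (3 ℕ.* k))
  [-8]^k≡[-1]^3k*2^3k k = begin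
    ((-1ℤ * + 2) ^ 3) ^ k                     ≡⟨ ^-*-assoc (-1ℤ * + 2) 3 k ⟩
    (-1ℤ * + 2) ^ (3 ℕ.* k)                   ≡⟨ ^-distrib-* -1ℤ (+ 2) (3 ℕ.* k) ⟩
    -1ℤ ^ (3 ℕ.* k) * (+ 2) ^ (3 ℕ.* k)       ≡⟨ cong (-1ℤ ^ (3 ℕ.* k) *_) (sym (pos-^ 2 (3 ℕ.* k))) ⟩
    -1ℤ ^ (3 ℕ.* k) * + (2 ℕ.^ (3 ℕ.* k))     ∎

  p²∣p*[-8]^k+3k*2^3k*pC3k : ∀ {p} → Prime p → ∀ k → 0 ℕ.< k → 3 ℕ.* k ℕ.< p →
    + p * + p ∣ + p * -[1+ 7 ] ^ k + + (3 ℕ.* k) * + (2 ℕ.^ (3 ℕ.* k) ℕ.* (p C (3 ℕ.* k)))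
  p²∣p*[-8]^k+3k*2^3k*pC3k {p} pr (suc k) _ j<p =
    subst (+ p * + p ∣_) (sym factor) (∣n⇒∣m*n (+ 2^j) (p²∣j*pCj+p*[-1]^j pr z<s j<p))
    where
    j = 3 ℕ.* suc k
    2^j = 2 ℕ.^ j
    collect : ∀ P J W C s → P * (s * W) + J * (W * C) ≡ W * (J * C + P * s)
    collect = solve-∀
    factor : + p * -[1+ 7 ] ^ suc k + + j * + (2^j ℕ.* (p C j)) ≡ + 2^j * (+ j * + (p C j) + + p * -1ℤ ^ j)
    factor = trans (cong₂ (λ x y → + p * x + + j * y) ([-8]^k≡[-1]^3k*2^3k (suc k)) (pos-* 2^j (p C j)))
                   (collect (+ p) (+ j) (+ 2^j) (+ (p C j)) (-1ℤ ^ j))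

  sumNeg8-numerator : ℕ → ℤ
  sumNeg8-numerator zero    = 0ℤ
  sumNeg8-numerator (suc m) = sumNeg8-numerator m * + suc m + -[1+ 7 ] ^ suc m * + (m !)

  p²∣p*numerator+3*m!*[trisection-1] : ∀ {p} → Prime p → ∀ m → 3 ℕ.* m ℕ.< p →
    + p * + p ∣ + p * sumNeg8-numerator m + + 3 * + (m !) * (+ trisection 0 m p - 1ℤ)
  p²∣p*numerator+3*m!*[trisection-1] {p} pr zero    _    = divides 0ℤ (base (+ p))
    where
    base : ∀ P → P * 0ℤ + + 3 * + 1 * (+ 1 - 1ℤ) ≡ 0ℤ * (P * P)
    base = solve-∀
  p²∣p*numerator+3*m!*[trisection-1] {p} pr (suc m) 3k<p = subst (+ p * + p ∣_) (sym regroup)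
    (∣m∣n⇒∣m+n (∣n⇒∣m*n K (p²∣p*numerator+3*m!*[trisection-1] pr m 3m<p))
               (∣n⇒∣m*n F (p²∣p*[-8]^k+3k*2^3k*pC3k pr (suc m) z<s 3k<p)))
    where
    P = + p
    K = + suc m
    F = + (m !)
    S = sumNeg8-numerator m
    E = -[1+ 7 ] ^ suc m
    A = trisection 0 m p
    T = 2 ℕ.^ (3 ℕ.* suc m) ℕ.* (p C (3 ℕ.* suc m))
    3m<p : 3 ℕ.* m ℕ.< p
    3m<p = ℕ.≤-<-trans (ℕ.*-monoʳ-≤ 3 (ℕ.n≤1+n m)) 3k<p
    rearrange : ∀ P K F S E A T → P * (S * K + E * F) + + 3 * (K * F) * ((A + T) - 1ℤ)
                                ≡ K * (P * S + + 3 * F * (A - 1ℤ)) + F * (P * E + + 3 * K * T)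
    rearrange = solve-∀
    regroup : P * (S * K + E * F) + + 3 * + (suc m ℕ.* m !) * (+ (A ℕ.+ T) - 1ℤ)
            ≡ K * (P * S + + 3 * F * (+ A - 1ℤ)) + F * (P * E + + (3 ℕ.* suc m) * + T)
    regroup = begin
      P * (S * K + E * F) + + 3 * + (suc m ℕ.* m !) * (+ (A ℕ.+ T) - 1ℤ)
        ≡⟨ cong₂ (λ x y → P * (S * K + E * F) + + 3 * x * (y - 1ℤ)) (pos-* (suc m) (m !)) (pos-+ A T) ⟩
      P * (S * K + E * F) + + 3 * (K * F) * ((+ A + + T) - 1ℤ)
        ≡⟨ rearrange P K F S E (+ A) (+ T) ⟩
      K * (P * S + + 3 * F * (+ A - 1ℤ)) + F * (P * E + + 3 * K * + T)
        ≡⟨ cong (λ x → K * (P * S + + 3 * F * (+ A - 1ℤ)) + F * (P * E + x * + T)) (sym (pos-* 3 (suc m))) ⟩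
      K * (P * S + + 3 * F * (+ A - 1ℤ)) + F * (P * E + + (3 ℕ.* suc m) * + T) ∎

module Fractions where
  open import Data.Nat.Base as ℕ using (ℕ; zero; suc; _!; NonZero)
  import Data.Nat.Properties as ℕ
  open import Data.Nat.Divisibility using (_∣_)
  open import Data.Integer.Base as ℤ using (ℤ; +_; -[1+_])
  import Data.Integer.Properties as ℤ
  import Data.Integer.Divisibility.Signed as ℤ
  open import Data.Integer.Tactic.RingSolver using (solve-∀)
  open import Data.Rational.Base using (_/_; _+_; _*_; -_; _-_; toℚᵘ)
  open import Data.Rational.Properties using (toℚᵘ-injective; toℚᵘ-fromℚᵘ; toℚᵘ-homo-+; toℚᵘ-homo-*; +-0-group; /-cong)
  import Data.Rational.Unnormalised.Base as ℚᵘ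
  import Data.Rational.Unnormalised.Properties as ℚᵘ
  open import Algebra.Properties.Group +-0-group using (⁻¹-involutive)
  open import Data.Product.Base using (_,_)
  open import Relation.Nullary.Negation using (¬_)
  open import Relation.Binary.PropositionalEquality
  open ≡-Reasoning
  open BinomialCongruences using (sumNeg8-numerator)

  toℚᵘ-/ : ∀ i n .{{_ : NonZero n}} → toℚᵘ (i / n) ℚᵘ.≃ i ℚᵘ./ n
  toℚᵘ-/ i (suc n) = toℚᵘ-fromℚᵘ (ℚᵘ.mkℚᵘ i n)

  *≡*⇒/≡/ : ∀ {a c : ℤ} {b d} .{{_ : NonZero b}} .{{_ : NonZero d}} → a ℤ.* + d ≡ c ℤ.* + b → a / b ≡ c / d
  *≡*⇒/≡/ {a} {c} {suc b} {suc d} eq =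
    toℚᵘ-injective (ℚᵘ.≃-trans (toℚᵘ-/ a (suc b)) (ℚᵘ.≃-trans (ℚᵘ.*≡* eq) (ℚᵘ.≃-sym (toℚᵘ-/ c (suc d)))))

  /-+-/ : ∀ a b c d .{{_ : NonZero b}} .{{_ : NonZero d}} →
        a / b + c / d ≡ ((a ℤ.* + d ℤ.+ c ℤ.* + b) / (b ℕ.* d)) {{ℕ.m*n≢0 b d}}
  /-+-/ a (suc b) c (suc d) = toℚᵘ-injective (ℚᵘ.≃-trans (toℚᵘ-homo-+ (a / suc b) (c / suc d))
    (ℚᵘ.≃-trans (ℚᵘ.+-cong (toℚᵘ-/ a (suc b)) (toℚᵘ-/ c (suc d))) (ℚᵘ.≃-sym (toℚᵘ-/ _ (suc b ℕ.* suc d)))))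

  /-*-/ : ∀ a b c d .{{_ : NonZero b}} .{{_ : NonZero d}} →
        (a / b) * (c / d) ≡ ((a ℤ.* c) / (b ℕ.* d)) {{ℕ.m*n≢0 b d}}
  /-*-/ a (suc b) c (suc d) = toℚᵘ-injective (ℚᵘ.≃-trans (toℚᵘ-homo-* (a / suc b) (c / suc d))
    (ℚᵘ.≃-trans (ℚᵘ.*-cong (toℚᵘ-/ a (suc b)) (toℚᵘ-/ c (suc d))) (ℚᵘ.≃-sym (toℚᵘ-/ _ (suc b ℕ.* suc d)))))

  sumNeg8≡numerator/m! : ∀ m → sumNeg8 m ≡ (sumNeg8-numerator m / m !) {{m ℕ.!≢0}}
  sumNeg8≡numerator/m! zero    = refl
  sumNeg8≡numerator/m! (suc m) = begin
    sumNeg8 m + E / suc m                                 ≡⟨ cong (_+ E / suc m) (sumNeg8≡numerator/m! m) ⟩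
    S / m ! + E / suc m                                   ≡⟨ /-+-/ S (m !) E (suc m) ⟩
    (S ℤ.* + suc m ℤ.+ E ℤ.* + (m !)) / (m ! ℕ.* suc m)
      ≡⟨ /-cong {S ℤ.* + suc m ℤ.+ E ℤ.* + (m !)} refl (ℕ.*-comm (m !) (suc m)) ⟩
    sumNeg8-numerator (suc m) / suc m !                   ∎
    where
    instance
      m!≢0 = m ℕ.!≢0
      m!*[1+m]≢0 = ℕ.m*n≢0 (m !) (suc m)
      [1+m]!≢0 = suc m ℕ.!≢0
    S = sumNeg8-numerator m
    E = -[1+ 7 ] ℤ.^ suc m

  ≡[modℚ]-criterion : ∀ {p} .{{_ : NonZero p}} (S Q c : ℤ) (D : ℕ) .{{_ : NonZero D}} → ¬ p ∣ D →
    (+ p) ℤ.* (+ p) ℤ.∣ (+ p) ℤ.* S ℤ.+ c ℤ.* (+ D) ℤ.* Q → (S / D) ≡ (- ((c / 1) * (Q / p))) [modℚ p ]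
  ≡[modℚ]-criterion {p} S Q c (suc d) p∤D (ℤ.divides a eq) = a , d , p∤D , (begin
    S / D - - ((c / 1) * (Q / p))                         ≡⟨ cong (λ x → S / D + x) (⁻¹-involutive _) ⟩
    S / D + (c / 1) * (Q / p)                             ≡⟨ cong (λ x → S / D + x) (/-*-/ c 1 Q p) ⟩
    S / D + (c ℤ.* Q) / (1 ℕ.* p)                         ≡⟨ /-+-/ S D (c ℤ.* Q) (1 ℕ.* p) ⟩
    (S ℤ.* + (1 ℕ.* p) ℤ.+ c ℤ.* Q ℤ.* + D) / (D ℕ.* (1 ℕ.* p))
      ≡⟨ *≡*⇒/≡/ {S ℤ.* + (1 ℕ.* p) ℤ.+ c ℤ.* Q ℤ.* + D} {+ p ℤ.* a} cross ⟩
    (+ p ℤ.* a) / D                                       ∎)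
    where
    D = suc d
    P = + p
    instance
      1*p≢0 = ℕ.m*n≢0 1 p
      D*[1*p]≢0 = ℕ.m*n≢0 D (1 ℕ.* p)
    clear : ∀ S P c Q D → (S ℤ.* (+ 1 ℤ.* P) ℤ.+ c ℤ.* Q ℤ.* D) ℤ.* D ≡ (P ℤ.* S ℤ.+ c ℤ.* D ℤ.* Q) ℤ.* D
    clear = solve-∀
    spread : ∀ a P D → a ℤ.* (P ℤ.* P) ℤ.* D ≡ (P ℤ.* a) ℤ.* (D ℤ.* (+ 1 ℤ.* P))
    spread = solve-∀
    cross : (S ℤ.* + (1 ℕ.* p) ℤ.+ c ℤ.* Q ℤ.* + D) ℤ.* + D ≡ (+ p ℤ.* a) ℤ.* + (D ℕ.* (1 ℕ.* p))
    cross = begin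
      (S ℤ.* + (1 ℕ.* p) ℤ.+ c ℤ.* Q ℤ.* + D) ℤ.* + D
        ≡⟨ cong (λ x → (S ℤ.* x ℤ.+ c ℤ.* Q ℤ.* + D) ℤ.* + D) (ℤ.pos-* 1 p) ⟩
      (S ℤ.* (+ 1 ℤ.* P) ℤ.+ c ℤ.* Q ℤ.* + D) ℤ.* + D  ≡⟨ clear S P c Q (+ D) ⟩
      (P ℤ.* S ℤ.+ c ℤ.* + D ℤ.* Q) ℤ.* + D             ≡⟨ cong (ℤ._* + D) eq ⟩
      a ℤ.* (P ℤ.* P) ℤ.* + D                           ≡⟨ spread a P (+ D) ⟩
      (P ℤ.* a) ℤ.* (+ D ℤ.* (+ 1 ℤ.* P))               ≡⟨ cong (λ x → (P ℤ.* a) ℤ.* (+ D ℤ.* x)) (sym (ℤ.pos-* 1 p)) ⟩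
      (P ℤ.* a) ℤ.* (+ D ℤ.* + (1 ℕ.* p))               ≡⟨ cong ((P ℤ.* a) ℤ.*_) (sym (ℤ.pos-* D (1 ℕ.* p))) ⟩
      (+ p ℤ.* a) ℤ.* + (D ℕ.* (1 ℕ.* p))               ∎

open import Data.Nat using (ℕ; _>_; _/_)
open import Data.Nat.Primality using (Prime; prime⇒nonZero)
open import Data.Integer using (+_)
open import Data.Rational using (-_; _*_) renaming (_/_ to _/ℚ_)
import Data.Nat as ℕ
import Data.Nat.Properties as ℕ
import Data.Integer as ℤ
import Data.Integer.Divisibility.Signed as ℤ
open import Data.Product using (proj₁)
open import Data.Nat.Divisibility using (_∣_)
open import Relation.Nullary.Negation using (¬_)
open import Relation.Binary.PropositionalEquality using (subst; sym)
open Primes using (small∤prime; ¬3∣⇒m/3-bounds; prime∤m!)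
open Trisection using (trisection-prime)
open BinomialCongruences using (sumNeg8-numerator; p²∣p*numerator+3*m!*[trisection-1])
open Fractions using (sumNeg8≡numerator/m!; ≡[modℚ]-criterion)

corollary4p7 : (p : ℕ) → (pr : Prime p) → p > 3 →
    sumNeg8 (p / 3) ≡ - ((+ 3 /ℚ 1) * fermatQuotient3 p {{prime⇒nonZero pr}}) [modℚ p ]
corollary4p7 p pr p>3 =
  subst (λ x → x ≡ - ((+ 3 /ℚ 1) * fermatQuotient3 p {{prime⇒nonZero pr}}) [modℚ p ])
        (sym (sumNeg8≡numerator/m! n))
        (≡[modℚ]-criterion {{prime⇒nonZero pr}} (sumNeg8-numerator n) _ (+ 3) (n ℕ.!) {{n ℕ.!≢0}} p∤n! p²∣p*numerator+3*n!*[3^[p-1]-1])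
  where
  n = p / 3
  3n<p : 3 ℕ.* n ℕ.< p
  3n<p = proj₁ (¬3∣⇒m/3-bounds p (small∤prime pr (ℕ.s<s ℕ.z<s) p>3))
  p∤n! : ¬ p ∣ n ℕ.!
  p∤n! = prime∤m! pr n (ℕ.≤-<-trans (ℕ.m≤n*m n 3) 3n<p)
  p²∣p*numerator+3*n!*[3^[p-1]-1] :
    + p ℤ.* + p ℤ.∣ + p ℤ.* sumNeg8-numerator n ℤ.+ + 3 ℤ.* + (n ℕ.!) ℤ.* (+ (3 ℕ.^ (p ℕ.∸ 1)) ℤ.- ℤ.1ℤ)
  p²∣p*numerator+3*n!*[3^[p-1]-1] rewrite sym (trisection-prime pr p>3) =
    p²∣p*numerator+3*m!*[trisection-1] pr n 3n<p
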